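{- For a nonempty finite set $S=\{i_1<i_2<\cdots<i_k\}$ of positive integers define the polynomial $$r_S(x_1,x_2,\ldots) = (x_{i_2} + \cdots + x_{i_k} - 1)(x_{i_3} + \cdots + x_{i_k} - 1) \cdots (x_{i_{k-1}}+x_{i_k} - 1) (x_{i_k} - 1),$$ with $r_S=1$ when $|S|=1$. Let $n\geq 2$, write $\mathbf x=(x_1,x_2,\ldots)$ and $\mathbf x/2=(x_1/2,x_2/2,\ldots)$. Then, as polynomials, $$r_{[n]}(\mathbf x) = 2^{n-1} r_{[n]}(\mathbf x/2) + \sum_{S:\ 1 \in S \subsetneq [n]} r_S(\mathbf x) \cdot r_{[n] \setminus S}(\mathbf x),$$ where $[n]=\{1,\dots,n\}$. -}

module Defs where

open import Data.Bool using (Bool; true; false; if_then_else_)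
open import Data.Nat as ℕ using (ℕ; zero; suc; _∸_)
open import Data.Integer using (+_)
open import Data.Rational using (ℚ; _+_; _*_; _-_; 1ℚ; 0ℚ; ½; _/_)
open import Data.Fin using (Fin; zero; suc)
open import Data.Vec using (Vec; []; _∷_)
open import Data.List using (List; []; _∷_; _++_; map; foldr; filter)
open import Data.Fin.Subset using (Subset; ⊤; ∁; _⊂_)
open import Data.Fin.Subset.Properties using (_∈?_; _⊂?_)
open import Data.Product using (_×_)
open import Relation.Nullary.Decidable using (_×-dec_)

sumℚ : List ℚ → ℚ
sumℚ = foldr _+_ 0ℚ

suffixProd : List ℚ → ℚ
suffixProd [] = 1ℚ
suffixProd (b ∷ bs) = (sumℚ (b ∷ bs) - 1ℚ) * suffixProd bs

-- r applied to the increasing list of values (x_{i₁}, …, x_{i_k}):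
-- the first value is dropped, the rest feed the product above.
-- (For k = 1 this gives 1, as in the paper.)
rList : List ℚ → ℚ
rList [] = 1ℚ
rList (a ∷ as) = suffixProd as

-- The values x_i for i ∈ S, listed in increasing order of i.
-- Element (Fin n) index j stands for the positive integer j+1,
-- so x : Fin n → ℚ is the tuple (x₁, …, xₙ).
select : ∀ {n} → Subset n → (Fin n → ℚ) → List ℚ
select [] x = []
select (true ∷ s) x = x zero ∷ select s (λ j → x (suc j))
select (false ∷ s) x = select s (λ j → x (suc j))

r : ∀ {n} → Subset n → (Fin n → ℚ) → ℚ
r S x = rList (select S x)

allSubsets : ∀ n → List (Subset n)
allSubsets zero = [] ∷ []
allSubsets (suc n) = map (true ∷_) (allSubsets n) ++ map (false ∷_) (allSubsets n)

-- The subsets S with 1 ∈ S ⊊ [n]  (1 corresponds to the index zero).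
admissible : ∀ n → List (Subset (suc n))
admissible n = filter (λ S → (zero ∈? S) ×-dec (S ⊂? ⊤)) (allSubsets (suc n))

half : ∀ {n} → (Fin n → ℚ) → (Fin n → ℚ)
half x i = x i * ½

pow2 : ℕ → ℚ
pow2 k = (+ (2 ℕ.^ k)) / 1

-- Let y = (x₂, …, xₙ). For a list L write P(L) for its suffix product (the factors ΣL′ − 1 over the
-- nonempty suffixes L′ of L), R(L) for P of the tail of L, and Q(L) for P with every − 1 replaced by − 2.
-- For S = {1} ∪ T we have r_S = P(T) and r_{[n]∖S} = R(y∖T). Splitting off x₂ and using
-- P(B) = (ΣB − 1) R(B) + 2·[B = ∅] gives by induction  Σ_{T ⊆ {2,…,n}} P(T) R(y∖T) = 2 P(y) − Q(y),
-- since the correction terms survive only for T = {2,…,n}. Rescaling each factor gives Q(y) = 2ⁿ⁻¹ P(y/2),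
-- and the summand T = {2,…,n} is P(y) = r_{[n]}; subtracting it leaves the identity.

module Submission where

open import Defs
open import Data.Nat using (ℕ; suc; _≤_; _∸_)
open import Data.Rational using (ℚ; _+_; _*_)
open import Data.Fin using (Fin)
open import Data.Fin.Subset using (⊤; ∁)
open import Data.List using (map)
open import Relation.Binary.PropositionalEquality using (_≡_)

open import Function using (id; _∘_)
open import Data.Bool using (true; false; if_then_else_)
open import Data.Nat as ℕ using (zero)
open import Data.Fin using (zero; suc)
import Data.Integer as ℤ
open import Data.Integer.Properties using (+◃n≡+n)
open import Data.Rational using (_-_; 1ℚ; 0ℚ; ½; _/_; mkℚ)
open import Data.Rational.Properties
  using (+-0-commutativeMonoid; normalize-coprime;
         +-assoc; +-identityˡ; +-identityʳ; *-identityʳ; *-zeroˡ; *-zeroʳ; *-distribʳ-+)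
open import Algebra.Bundles using (CommutativeMonoid)
open import Algebra.Properties.CommutativeSemigroup (CommutativeMonoid.commutativeSemigroup +-0-commutativeMonoid)
  using (interchange; x∙yz≈y∙xz; xy∙z≈xz∙y)
open import Data.Nat.Coprimality using (Coprime; 1-coprimeTo) renaming (sym to coprime-sym)
open import Data.List using (List; []; _∷_; _++_; filter; length)
open import Data.List.Properties using (map-∘; map-id)
open import Data.Vec using ([]; _∷_)
open import Data.Fin.Subset using (Subset)
open import Data.Fin.Subset.Properties using (_⊂?_; _⊆?_; ⊆⊤)
open import Relation.Nullary using (does)
open import Relation.Nullary.Decidable using (dec-true)
open import Relation.Unary using (Pred; Decidable)
open import Relation.Binary.PropositionalEquality using (refl; sym; trans; cong; cong₂; module ≡-Reasoning)
open import Data.Rational.Solver using (module +-*-Solver)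

open ≡-Reasoning
open +-*-Solver

two : ℚ
two = 1ℚ + 1ℚ

-- In mkℚ form the factor 2ᵏ is visibly normalised, so multiplying by two computes to 2ᵏ⁺¹ / 1.
pow2-suc : ∀ k → pow2 (suc k) ≡ two * pow2 k
pow2-suc k = begin
  ℤ.+ (2 ℕ.^ suc k) / 1                      ≡⟨ cong (_/ 1) (+◃n≡+n (2 ℕ.^ suc k)) ⟨
  two * mkℚ (ℤ.+ 2 ℕ.^ k) 0 2ᵏ-coprime-1      ≡⟨ cong (two *_) (normalize-coprime {2 ℕ.^ k} {0} 2ᵏ-coprime-1) ⟨
  two * pow2 k                               ∎
  where
  2ᵏ-coprime-1 : Coprime (2 ℕ.^ k) 1
  2ᵏ-coprime-1 = coprime-sym (1-coprimeTo (2 ℕ.^ k))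

∑ : ∀ {a} {A : Set a} → List A → (A → ℚ) → ℚ
∑ xs f = sumℚ (map f xs)

syntax ∑ xs (λ x → e) = ∑[ x ∈ xs ] e

module _ {a} {A : Set a} where

  ∑-++ : ∀ (xs ys : List A) f → ∑ (xs ++ ys) f ≡ ∑ xs f + ∑ ys f
  ∑-++ []       ys f = sym (+-identityˡ _)
  ∑-++ (x ∷ xs) ys f = trans (cong (f x +_) (∑-++ xs ys f)) (sym (+-assoc (f x) (∑ xs f) (∑ ys f)))

  ∑-cong : ∀ (xs : List A) {f g} → (∀ x → f x ≡ g x) → ∑ xs f ≡ ∑ xs g
  ∑-cong []       f≡g = refl
  ∑-cong (x ∷ xs) f≡g = cong₂ _+_ (f≡g x) (∑-cong xs f≡g)

  ∑-+ : ∀ (xs : List A) f g → ∑[ x ∈ xs ] (f x + g x) ≡ ∑ xs f + ∑ xs g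
  ∑-+ []       f g = refl
  ∑-+ (x ∷ xs) f g = trans (cong (f x + g x +_) (∑-+ xs f g)) (interchange (f x) (g x) (∑ xs f) (∑ xs g))

  ∑-*ʳ : ∀ (xs : List A) f c → ∑[ x ∈ xs ] (f x * c) ≡ ∑ xs f * c
  ∑-*ʳ []       f c = sym (*-zeroˡ c)
  ∑-*ʳ (x ∷ xs) f c = trans (cong (f x * c +_) (∑-*ʳ xs f c)) (sym (*-distribʳ-+ c (f x) (∑ xs f)))

  ∑-zero : ∀ (xs : List A) → ∑[ x ∈ xs ] 0ℚ ≡ 0ℚ
  ∑-zero []       = refl
  ∑-zero (x ∷ xs) = cong (0ℚ +_) (∑-zero xs)

  ∑-filter : ∀ {p} {P : Pred A p} (P? : Decidable P) xs f →
             ∑ (filter P? xs) f ≡ ∑[ x ∈ xs ] (if does (P? x) then f x else 0ℚ)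
  ∑-filter P? []       f = refl
  ∑-filter P? (x ∷ xs) f with does (P? x)
  ... | true  = cong (f x +_) (∑-filter P? xs f)
  ... | false = trans (∑-filter P? xs f) (sym (+-identityˡ _))

∑-allSubsets-suc : ∀ m (f : Subset (suc m) → ℚ) →
  ∑[ s ∈ allSubsets (suc m) ] f s ≡ ∑[ s ∈ allSubsets m ] f (true ∷ s) + ∑[ s ∈ allSubsets m ] f (false ∷ s)
∑-allSubsets-suc m f = begin
  ∑ (map (true ∷_) A ++ map (false ∷_) A) f        ≡⟨ ∑-++ (map (true ∷_) A) (map (false ∷_) A) f ⟩
  ∑ (map (true ∷_) A) f + ∑ (map (false ∷_) A) f   ≡⟨ cong₂ _+_ (cong sumℚ (map-∘ A)) (cong sumℚ (map-∘ A)) ⟨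
  ∑ A (f ∘ (true ∷_)) + ∑ A (f ∘ (false ∷_))       ∎
  where
  A : List (Subset m)
  A = allSubsets m

∑-proper+⊤ : ∀ m (g : Subset m → ℚ) →
  ∑[ s ∈ allSubsets m ] (if does (s ⊂? ⊤) then g s else 0ℚ) + g ⊤ ≡ ∑[ s ∈ allSubsets m ] g s
∑-proper+⊤ zero    g = trans (+-identityˡ (g [])) (sym (+-identityʳ (g [])))
∑-proper+⊤ (suc m) g = begin
  ∑ (allSubsets (suc m)) proper + g ⊤
    ≡⟨ cong (_+ g ⊤) (∑-allSubsets-suc m proper) ⟩
  ∑ A (proper ∘ (true ∷_)) + ∑ A (proper ∘ (false ∷_)) + g ⊤
    ≡⟨ cong (λ t → ∑ A (proper ∘ (true ∷_)) + t + g ⊤) (∑-cong A proper-false) ⟩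
  ∑ A (proper ∘ (true ∷_)) + ∑ A (g ∘ (false ∷_)) + g ⊤
    ≡⟨ xy∙z≈xz∙y (∑ A (proper ∘ (true ∷_))) (∑ A (g ∘ (false ∷_))) (g ⊤) ⟩
  ∑ A (proper ∘ (true ∷_)) + g ⊤ + ∑ A (g ∘ (false ∷_))
    ≡⟨ cong (_+ ∑ A (g ∘ (false ∷_))) (∑-proper+⊤ m (g ∘ (true ∷_))) ⟩
  ∑ A (g ∘ (true ∷_)) + ∑ A (g ∘ (false ∷_))
    ≡⟨ ∑-allSubsets-suc m g ⟨
  ∑ (allSubsets (suc m)) g ∎
  where
  A : List (Subset m)
  A = allSubsets m
  proper : Subset (suc m) → ℚ
  proper s = if does (s ⊂? ⊤) then g s else 0ℚ
  proper-false : ∀ s → proper (false ∷ s) ≡ g (false ∷ s)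
  proper-false s = cong (λ b → if b then g (false ∷ s) else 0ℚ) (dec-true (s ⊆? ⊤) ⊆⊤)

∑-admissible : ∀ m (f : Subset (suc m) → ℚ) →
  ∑[ S ∈ admissible m ] f S + f ⊤ ≡ ∑[ s ∈ allSubsets m ] f (true ∷ s)
∑-admissible m f = begin
  ∑ (admissible m) f + f ⊤
    ≡⟨ cong (_+ f ⊤) (trans (∑-filter _ (allSubsets (suc m)) f) (∑-allSubsets-suc m _)) ⟩
  proper + ∑[ s ∈ A ] 0ℚ + f ⊤
    ≡⟨ cong (_+ f ⊤) (trans (cong (proper +_) (∑-zero A)) (+-identityʳ proper)) ⟩
  proper + f ⊤
    ≡⟨ ∑-proper+⊤ m (f ∘ (true ∷_)) ⟩
  ∑ A (f ∘ (true ∷_)) ∎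
  where
  A : List (Subset m)
  A = allSubsets m
  proper : ℚ
  proper = ∑[ s ∈ A ] (if does (s ⊂? ⊤) then f (true ∷ s) else 0ℚ)

sumℚ-select-∁ : ∀ {m} (s : Subset m) (y : Fin m → ℚ) →
  sumℚ (select s y) + sumℚ (select (∁ s) y) ≡ sumℚ (select ⊤ y)
sumℚ-select-∁ []          y = refl
sumℚ-select-∁ (true ∷ s)  y = trans (+-assoc (y zero) σ σᶜ) (cong (y zero +_) (sumℚ-select-∁ s (y ∘ suc)))
  where σ σᶜ : ℚ
        σ  = sumℚ (select s (y ∘ suc))
        σᶜ = sumℚ (select (∁ s) (y ∘ suc))
sumℚ-select-∁ (false ∷ s) y = trans (x∙yz≈y∙xz σ (y zero) σᶜ) (cong (y zero +_) (sumℚ-select-∁ s (y ∘ suc)))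
  where σ σᶜ : ℚ
        σ  = sumℚ (select s (y ∘ suc))
        σᶜ = sumℚ (select (∁ s) (y ∘ suc))

select-∁⊤ : ∀ {m} (y : Fin m → ℚ) → select (∁ ⊤) y ≡ []
select-∁⊤ {zero}  y = refl
select-∁⊤ {suc m} y = select-∁⊤ (y ∘ suc)

select-∘ : ∀ {m} (s : Subset m) (f : ℚ → ℚ) (y : Fin m → ℚ) → select s (f ∘ y) ≡ map f (select s y)
select-∘ []          f y = refl
select-∘ (true ∷ s)  f y = cong (f (y zero) ∷_) (select-∘ s f (y ∘ suc))
select-∘ (false ∷ s) f y = select-∘ s f (y ∘ suc)

length-select-⊤ : ∀ {m} (y : Fin m → ℚ) → length (select ⊤ y) ≡ m
length-select-⊤ {zero}  y = refl
length-select-⊤ {suc m} y = cong suc (length-select-⊤ (y ∘ suc))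

𝟙-nil : List ℚ → ℚ
𝟙-nil []      = 1ℚ
𝟙-nil (_ ∷ _) = 0ℚ

suffixProd₂ : List ℚ → ℚ
suffixProd₂ []       = 1ℚ
suffixProd₂ (b ∷ bs) = (sumℚ (b ∷ bs) - two) * suffixProd₂ bs

suffixProd-rList : ∀ bs → suffixProd bs ≡ (sumℚ bs - 1ℚ) * rList bs + two * 𝟙-nil bs
suffixProd-rList []       = refl
suffixProd-rList (b ∷ bs) = sym (+-identityʳ (suffixProd (b ∷ bs)))

∑-𝟙-nil-select-∁ : ∀ m (F : Subset m → ℚ) (y : Fin m → ℚ) →
  ∑[ s ∈ allSubsets m ] (F s * 𝟙-nil (select (∁ s) y)) ≡ F ⊤
∑-𝟙-nil-select-∁ zero    F y = trans (+-identityʳ (F [] * 1ℚ)) (*-identityʳ (F []))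
∑-𝟙-nil-select-∁ (suc m) F y = begin
  ∑[ s ∈ allSubsets (suc m) ] (F s * 𝟙-nil (select (∁ s) y))
    ≡⟨ ∑-allSubsets-suc m _ ⟩
  ∑[ s ∈ A ] (F (true ∷ s) * 𝟙-nil (select (∁ s) (y ∘ suc))) + ∑[ s ∈ A ] (F (false ∷ s) * 0ℚ)
    ≡⟨ cong₂ _+_ (∑-𝟙-nil-select-∁ m (F ∘ (true ∷_)) (y ∘ suc)) (∑-*ʳ A (F ∘ (false ∷_)) 0ℚ) ⟩
  F ⊤ + ∑ A (F ∘ (false ∷_)) * 0ℚ
    ≡⟨ cong (F ⊤ +_) (*-zeroʳ (∑ A (F ∘ (false ∷_)))) ⟩
  F ⊤ + 0ℚ
    ≡⟨ +-identityʳ (F ⊤) ⟩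
  F ⊤ ∎
  where
  A : List (Subset m)
  A = allSubsets m

∑-suffixProd-rList : ∀ m (y : Fin m → ℚ) →
  ∑[ s ∈ allSubsets m ] (suffixProd (select s y) * rList (select (∁ s) y))
    ≡ two * suffixProd (select ⊤ y) - suffixProd₂ (select ⊤ y)
∑-suffixProd-rList zero    y = refl
∑-suffixProd-rList (suc m) y = begin
  ∑ (allSubsets (suc m)) term
    ≡⟨ ∑-allSubsets-suc m term ⟩
  ∑ A (term ∘ (true ∷_)) + ∑ A (term ∘ (false ∷_))
    ≡⟨ ∑-+ A (term ∘ (true ∷_)) (term ∘ (false ∷_)) ⟨
  ∑[ s ∈ A ] (term (true ∷ s) + term (false ∷ s))
    ≡⟨ ∑-cong A merge ⟩
  ∑[ s ∈ A ] (term′ s * c + two * P s * 𝟙-nil (select (∁ s) y′))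
    ≡⟨ ∑-+ A (λ s → term′ s * c) (λ s → two * P s * 𝟙-nil (select (∁ s) y′)) ⟩
  ∑[ s ∈ A ] (term′ s * c) + ∑[ s ∈ A ] (two * P s * 𝟙-nil (select (∁ s) y′))
    ≡⟨ cong₂ _+_ (∑-*ʳ A term′ c) (∑-𝟙-nil-select-∁ m (λ s → two * P s) y′) ⟩
  ∑ A term′ * c + two * P ⊤
    ≡⟨ cong (λ t → t * c + two * P ⊤) (∑-suffixProd-rList m y′) ⟩
  (two * P ⊤ - Q) * c + two * P ⊤
    ≡⟨ collect (y zero) σ (P ⊤) Q ⟩
  two * (((y zero + σ) - 1ℚ) * P ⊤) - ((y zero + σ) - two) * Q ∎
  where
  A : List (Subset m)
  A = allSubsets m
  y′ : Fin m → ℚ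
  y′ = y ∘ suc
  term : Subset (suc m) → ℚ
  term s = suffixProd (select s y) * rList (select (∁ s) y)
  term′ P : Subset m → ℚ
  term′ s = suffixProd (select s y′) * rList (select (∁ s) y′)
  P s = suffixProd (select s y′)
  σ Q c : ℚ
  σ = sumℚ (select ⊤ y′)
  Q = suffixProd₂ (select ⊤ y′)
  c = (y zero + σ) - two

  regroup : ∀ y₀ a b p w d →
    ((y₀ + a) - 1ℚ) * p * w + p * ((b - 1ℚ) * w + two * d) ≡ p * w * ((y₀ + (a + b)) - two) + two * p * d
  regroup = solve 6 (λ y₀ a b p w d →
    ((y₀ :+ a) :- con 1ℚ) :* p :* w :+ p :* ((b :- con 1ℚ) :* w :+ con two :* d)
      := p :* w :* ((y₀ :+ (a :+ b)) :- con two) :+ con two :* p :* d) refl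

  collect : ∀ y₀ σ p q →
    (two * p - q) * ((y₀ + σ) - two) + two * p ≡ two * (((y₀ + σ) - 1ℚ) * p) - ((y₀ + σ) - two) * q
  collect = solve 4 (λ y₀ σ p q →
    (con two :* p :- q) :* ((y₀ :+ σ) :- con two) :+ con two :* p
      := con two :* (((y₀ :+ σ) :- con 1ℚ) :* p) :- ((y₀ :+ σ) :- con two) :* q) refl

  merge : ∀ s → term (true ∷ s) + term (false ∷ s) ≡ term′ s * c + two * P s * 𝟙-nil (select (∁ s) y′)
  merge s = begin
    ((y zero + a) - 1ℚ) * P s * w + P s * suffixProd B
      ≡⟨ cong (λ t → ((y zero + a) - 1ℚ) * P s * w + P s * t) (suffixProd-rList B) ⟩
    ((y zero + a) - 1ℚ) * P s * w + P s * ((sumℚ B - 1ℚ) * w + two * 𝟙-nil B)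
      ≡⟨ regroup (y zero) a (sumℚ B) (P s) w (𝟙-nil B) ⟩
    P s * w * ((y zero + (a + sumℚ B)) - two) + two * P s * 𝟙-nil B
      ≡⟨ cong (λ t → P s * w * ((y zero + t) - two) + two * P s * 𝟙-nil B) (sumℚ-select-∁ s y′) ⟩
    P s * w * c + two * P s * 𝟙-nil B ∎
    where
    a w : ℚ
    a = sumℚ (select s y′)
    B : List ℚ
    B = select (∁ s) y′
    w = rList B

suffixProd-halve : ∀ bs → pow2 (length bs) * suffixProd (map (_* ½) bs) ≡ suffixProd₂ bs
suffixProd-halve []       = refl
suffixProd-halve (b ∷ bs) = begin
  pow2 (suc k) * (((b * ½ + sumℚ (map (_* ½) bs)) - 1ℚ) * p)
    ≡⟨ cong₂ (λ t σ → t * (((b * ½ + σ) - 1ℚ) * p)) (pow2-suc k) sumℚ-halve ⟩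
  two * pow2 k * (((b * ½ + sumℚ bs * ½) - 1ℚ) * p)
    ≡⟨ double-factor b (sumℚ bs) (pow2 k) p ⟩
  ((b + sumℚ bs) - two) * (pow2 k * p)
    ≡⟨ cong (((b + sumℚ bs) - two) *_) (suffixProd-halve bs) ⟩
  ((b + sumℚ bs) - two) * suffixProd₂ bs ∎
  where
  k : ℕ
  k = length bs
  p : ℚ
  p = suffixProd (map (_* ½) bs)
  sumℚ-halve : sumℚ (map (_* ½) bs) ≡ sumℚ bs * ½
  sumℚ-halve = trans (∑-*ʳ bs id ½) (cong (λ cs → sumℚ cs * ½) (map-id bs))
  double-factor : ∀ b σ t p → two * t * (((b * ½ + σ * ½) - 1ℚ) * p) ≡ ((b + σ) - two) * (t * p)
  double-factor = solve 4 (λ b σ t p →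
    con two :* t :* (((b :* con ½ :+ σ :* con ½) :- con 1ℚ) :* p)
      := ((b :+ σ) :- con two) :* (t :* p)) refl

suffixProd-select-half : ∀ {m} (y : Fin m → ℚ) →
  pow2 m * suffixProd (select ⊤ (half y)) ≡ suffixProd₂ (select ⊤ y)
suffixProd-select-half {m} y = begin
  pow2 m * suffixProd (select ⊤ (half y))
    ≡⟨ cong₂ (λ k bs → pow2 k * suffixProd bs) (sym (length-select-⊤ y)) (select-∘ ⊤ (_* ½) y) ⟩
  pow2 (length (select ⊤ y)) * suffixProd (map (_* ½) (select ⊤ y))
    ≡⟨ suffixProd-halve (select ⊤ y) ⟩
  suffixProd₂ (select ⊤ y) ∎

lemma3p2 : (m : ℕ) → 2 ≤ suc m → (x : Fin (suc m) → ℚ) →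
    r ⊤ x ≡ pow2 m * r ⊤ (half x)
    + sumℚ (map (λ S → r S x * r (∁ S) x) (admissible m))
lemma3p2 m _ x = sym (begin
  pow2 m * P (half y) + ∑ (admissible m) f
    ≡⟨ cong (_+ ∑ (admissible m) f) (suffixProd-select-half y) ⟩
  Q + ∑ (admissible m) f
    ≡⟨ add-sub Q (∑ (admissible m) f) (f ⊤) ⟩
  Q + (∑ (admissible m) f + f ⊤) - f ⊤
    ≡⟨ cong (λ t → Q + t - f ⊤) (trans (∑-admissible m f) (∑-suffixProd-rList m y)) ⟩
  Q + (two * P y - Q) - P y * rList (select (∁ ⊤) y)
    ≡⟨ cong (λ bs → Q + (two * P y - Q) - P y * rList bs) (select-∁⊤ y) ⟩
  Q + (two * P y - Q) - P y * 1ℚ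
    ≡⟨ cancel Q (P y) ⟩
  P y ∎)
  where
  y : Fin m → ℚ
  y = x ∘ suc
  P : (Fin m → ℚ) → ℚ
  P z = suffixProd (select ⊤ z)
  Q : ℚ
  Q = suffixProd₂ (select ⊤ y)
  f : Subset (suc m) → ℚ
  f S = r S x * r (∁ S) x

  add-sub : ∀ q a t → q + a ≡ q + (a + t) - t
  add-sub = solve 3 (λ q a t → q :+ a := q :+ (a :+ t) :- t) refl
  cancel : ∀ q p → q + (two * p - q) - p * 1ℚ ≡ p
  cancel = solve 2 (λ q p → q :+ (con two :* p :- q) :- p :* con 1ℚ := p) refl
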